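{- Let $\varphi$ be a quantifier-free $\mathcal{T}$-formula and $\boldsymbol{\alpha}$ a finite set of atoms containing all atoms of $\varphi$. Let $\{C_1,\ldots,C_K\}$ be a set of $\mathcal{T}$-lemmas on $\boldsymbol{\alpha}$ which rules out $P_{\boldsymbol{\alpha}}(\varphi)$, and let $\mathrm{Tred}(\varphi)=\varphi\wedge\bigwedge_{l=1}^K C_l$. Then (i) $\mathrm{Tred}(\varphi)\equiv_{\mathcal{T}}\varphi$; (ii) $\mathrm{Tred}(\varphi)\models_p\varphi$; (iii) $\mathrm{Tred}(\varphi)$ is $\mathcal{T}$-reduced with respect to $\boldsymbol{\alpha}$.
   Context: $\mathcal{T}$-formulas are quantifier-free formulas built by Boolean connectives from $\mathcal{T}$-atoms and Boolean atoms. The Boolean abstraction maps each atom bijectively to a Boolean variable; $\varphi\models_p\psi$ means the Boolean abstraction of $\varphi$ entails that of $\psi$ propositionally. $\equiv_{\mathcal{T}}$ is equivalence modulo $\mathcal{T}$. A $\mathcal{T}$-lemma is a $\mathcal{T}$-valid clause. A total truth assignment on $\boldsymbol{\alpha}$ is a conjunction containing, for each $a\in\boldsymbol{\alpha}$, exactly one of $a,\neg a$. $P_{\boldsymbol{\alpha}}(\psi)$ is the set of $\mathcal{T}$-unsatisfiable total truth assignments $\rho$ on $\boldsymbol{\alpha}$ with $\rho\models_p\psi$. A set of $\mathcal{T}$-lemmas $\{C_1,\dots,C_K\}$ rules out a set $\{\rho_1,\dots,\rho_M\}$ of $\mathcal{T}$-unsatisfiable total truth assignments iff for every $\rho_j$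 there is some $C_l$ with $\rho_j\models_p\neg C_l$. A formula $\psi$ is $\mathcal{T}$-reduced with respect to $\boldsymbol{\alpha}$ iff $P_{\boldsymbol{\alpha}}(\psi)=\emptyset$. -}

module Defs where

open import Data.Bool using (Bool; true; false; _∧_; _∨_; not)
open import Data.List using (List; []; _∷_; map; _++_)
open import Data.List.Membership.Propositional using (_∈_)
open import Data.Product using (Σ; ∃; _×_; _,_; proj₁; proj₂)
open import Relation.Binary.PropositionalEquality using (_≡_)
open import Relation.Nullary using (¬_)

record Theory (Atom : Set) : Set₁ where
  field
    Model : Set
    ⟦_⟧ₐ : Model → Atom → Bool
open Theory public

data Formula (Atom : Set) : Set where
  atom  : Atom → Formula Atom
  ⊤ᶠ ⊥ᶠ : Formula Atom
  ¬ᶠ_   : Formula Atom → Formula Atom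
  _∧ᶠ_ _∨ᶠ_ _⇒ᶠ_ _⇔ᶠ_ : Formula Atom → Formula Atom → Formula Atom

module _ {Atom : Set} where

  atoms : Formula Atom → List Atom
  atoms (atom a) = a ∷ []
  atoms ⊤ᶠ = []
  atoms ⊥ᶠ = []
  atoms (¬ᶠ f) = atoms f
  atoms (f ∧ᶠ g) = atoms f ++ atoms g
  atoms (f ∨ᶠ g) = atoms f ++ atoms g
  atoms (f ⇒ᶠ g) = atoms f ++ atoms g
  atoms (f ⇔ᶠ g) = atoms f ++ atoms g

  -- An arbitrary v : Atom → Bool is a propositional assignment to the Boolean
  -- abstraction (which maps atoms bijectively to Boolean variables).
  eval : (Atom → Bool) → Formula Atom → Bool
  eval v (atom a) = v a
  eval v ⊤ᶠ = true
  eval v ⊥ᶠ = false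
  eval v (¬ᶠ f) = not (eval v f)
  eval v (f ∧ᶠ g) = eval v f ∧ eval v g
  eval v (f ∨ᶠ g) = eval v f ∨ eval v g
  eval v (f ⇒ᶠ g) = not (eval v f) ∨ eval v g
  eval v (f ⇔ᶠ g) with eval v f | eval v g
  ... | true  | true  = true
  ... | false | false = true
  ... | _     | _     = false

  ⋀ : List (Formula Atom) → Formula Atom
  ⋀ [] = ⊤ᶠ
  ⋀ (f ∷ fs) = f ∧ᶠ ⋀ fs

  ⋁ : List (Formula Atom) → Formula Atom
  ⋁ [] = ⊥ᶠ
  ⋁ (f ∷ fs) = f ∨ᶠ ⋁ fs

  Literal : Set
  Literal = Atom × Bool

  litF : Literal → Formula Atom
  litF (a , true)  = atom a
  litF (a , false) = ¬ᶠ atom a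

  Clause : Set
  Clause = List Literal

  clauseF : Clause → Formula Atom
  clauseF c = ⋁ (map litF c)

  _⊆ₗ_ : List Atom → List Atom → Set
  xs ⊆ₗ ys = ∀ {a} → a ∈ xs → a ∈ ys

  _⊨p_ : Formula Atom → Formula Atom → Set
  φ ⊨p ψ = ∀ (v : Atom → Bool) → eval v φ ≡ true → eval v ψ ≡ true

  module _ (T : Theory Atom) where

    T-Sat : Formula Atom → Set
    T-Sat φ = Σ (Model T) λ M → eval (⟦_⟧ₐ T M) φ ≡ true

    T-Unsat : Formula Atom → Set
    T-Unsat φ = ¬ T-Sat φ

    T-Valid : Formula Atom → Set
    T-Valid φ = ∀ (M : Model T) → eval (⟦_⟧ₐ T M) φ ≡ true

    _≡T_ : Formula Atom → Formula Atom → Set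
    φ ≡T ψ = ∀ (M : Model T) → eval (⟦_⟧ₐ T M) φ ≡ eval (⟦_⟧ₐ T M) ψ

    IsTLemmaOn : List Atom → Clause → Set
    IsTLemmaOn α c = T-Valid (clauseF c) × (map proj₁ c ⊆ₗ α)

    -- Total truth assignments on α: for each a ∈ α exactly one of a, ¬a,
    -- determined by a choice σ : Atom → Bool (only its values on α matter).
    totalAssign : List Atom → (Atom → Bool) → Formula Atom
    totalAssign α σ = ⋀ (map (λ a → litF (a , σ a)) α)

    InP : List Atom → Formula Atom → (Atom → Bool) → Set
    InP α ψ σ = T-Unsat (totalAssign α σ) × (totalAssign α σ ⊨p ψ)

    RulesOut : List Clause → List Atom → Formula Atom → Set
    RulesOut Cs α ψ = ∀ σ → InP α ψ σ →
      Σ Clause λ C → C ∈ Cs × (totalAssign α σ ⊨p (¬ᶠ clauseF C))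

    TReduced : List Atom → Formula Atom → Set
    TReduced α ψ = ∀ σ → ¬ InP α ψ σ

  Tred : Formula Atom → List Clause → Formula Atom
  Tred φ Cs = φ ∧ᶠ ⋀ (map clauseF Cs)

-- Conjoining T-valid clauses changes no T-model's verdict, and drops nothing
-- propositionally, so (i) and (ii) hold for any such conjunct. For (iii), a
-- T-unsatisfiable total assignment ρ = σ|α entailing Tred(φ) also entails φ, so
-- some lemma C has ρ ⊨p ¬C; but σ itself satisfies ρ, hence both Tred(φ),
-- which contains C, and ¬C.
module Submission where

open import Defs
open import Data.Bool using (Bool; true; false; _∧_; not)
open import Data.List using (List; []; _∷_; map)
open import Data.List.Membership.Propositional using (_∈_)
open import Data.List.Membership.Propositional.Properties using (∈-map⁺)
open import Data.List.Relation.Unary.All as All using (All; []; _∷_)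
import Data.List.Relation.Unary.All.Properties as All
open import Data.List.Relation.Unary.Any using (here; there)
open import Data.Product using (_×_; _,_; proj₁)
open import Relation.Binary.PropositionalEquality using (_≡_; _≢_; refl; cong)

∧-true⇒ˡ : ∀ {a b} → a ∧ b ≡ true → a ≡ true
∧-true⇒ˡ {true} _ = refl

∧-true⇒ʳ : ∀ {a b} → a ∧ b ≡ true → b ≡ true
∧-true⇒ʳ {true} b≡true = b≡true

∧-true-intro : ∀ {a b} → a ≡ true → b ≡ true → a ∧ b ≡ true
∧-true-intro refl refl = refl

∧-identityʳ-true : ∀ a {b} → b ≡ true → a ∧ b ≡ a
∧-identityʳ-true true  b≡true = b≡true
∧-identityʳ-true false _      = refl

not-true⇒≢true : ∀ {b} → not b ≡ true → b ≢ true
not-true⇒≢true {true} ()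

module _ {Atom : Set} where

  eval-litF-self : (σ : Atom → Bool) (a : Atom) → eval σ (litF (a , σ a)) ≡ true
  eval-litF-self σ a with σ a in σa≡
  ... | true  = σa≡
  ... | false = cong not σa≡

  eval-totalAssign-self : (T : Theory Atom) (α : List Atom) (σ : Atom → Bool) →
    eval σ (totalAssign T α σ) ≡ true
  eval-totalAssign-self T []      σ = refl
  eval-totalAssign-self T (a ∷ α) σ =
    ∧-true-intro (eval-litF-self σ a) (eval-totalAssign-self T α σ)

  eval-⋀-∈ : (v : Atom → Bool) {f : Formula Atom} {fs : List (Formula Atom)} →
    f ∈ fs → eval v (⋀ fs) ≡ true → eval v f ≡ true
  eval-⋀-∈ v (here refl) ⋀fs≡true = ∧-true⇒ˡ ⋀fs≡true
  eval-⋀-∈ v {fs = g ∷ _} (there f∈fs) ⋀fs≡true =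
    eval-⋀-∈ v f∈fs (∧-true⇒ʳ {eval v g} ⋀fs≡true)

  ∧ᶠ-⊨p-left : (φ ψ : Formula Atom) → (φ ∧ᶠ ψ) ⊨p φ
  ∧ᶠ-⊨p-left φ ψ v = ∧-true⇒ˡ

  module _ (T : Theory Atom) where

    T-Valid-⋀ : {fs : List (Formula Atom)} → All (T-Valid T) fs → T-Valid T (⋀ fs)
    T-Valid-⋀ []                   M = refl
    T-Valid-⋀ (f-valid ∷ fs-valid) M = ∧-true-intro (f-valid M) (T-Valid-⋀ fs-valid M)

    ∧ᶠ-T-Valid-≡T : (φ ψ : Formula Atom) → T-Valid T ψ → _≡T_ T (φ ∧ᶠ ψ) φ
    ∧ᶠ-T-Valid-≡T φ ψ ψ-valid M = ∧-identityʳ-true (eval (⟦_⟧ₐ T M) φ) (ψ-valid M)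

    ⋀-clauseF-T-Valid : {α : List Atom} (Cs : List Clause) →
      All (IsTLemmaOn T α) Cs → T-Valid T (⋀ (map clauseF Cs))
    ⋀-clauseF-T-Valid Cs Cs-lemmas = T-Valid-⋀ (All.map⁺ (All.map proj₁ Cs-lemmas))

    RulesOut⇒TReduced-Tred : (φ : Formula Atom) (α : List Atom) (Cs : List Clause) →
      RulesOut T Cs α φ → TReduced T α (Tred φ Cs)
    RulesOut⇒TReduced-Tred φ α Cs rulesOut σ (unsat , ρ⊨Tred)
      with rulesOut σ (unsat , λ v ρ≡true → ∧-true⇒ˡ (ρ⊨Tred v ρ≡true))
    ... | C , C∈Cs , ρ⊨¬C = not-true⇒≢true (ρ⊨¬C σ σ⊨ρ) σ⊨C
      where
      σ⊨ρ : eval σ (totalAssign T α σ) ≡ true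
      σ⊨ρ = eval-totalAssign-self T α σ
      σ⊨C : eval σ (clauseF C) ≡ true
      σ⊨C = eval-⋀-∈ σ (∈-map⁺ clauseF C∈Cs) (∧-true⇒ʳ {eval σ φ} (ρ⊨Tred σ σ⊨ρ))

theorem4p11 : {Atom : Set} (T : Theory Atom) (φ : Formula Atom) (α : List Atom)
    → atoms φ ⊆ₗ α
    → (Cs : List Clause)
    → All (IsTLemmaOn T α) Cs
    → RulesOut T Cs α φ
    → (_≡T_ T (Tred φ Cs) φ) × (Tred φ Cs ⊨p φ) × TReduced T α (Tred φ Cs)
theorem4p11 T φ α _ Cs lemmas rulesOut =
    ∧ᶠ-T-Valid-≡T T φ (⋀ (map clauseF Cs)) (⋀-clauseF-T-Valid T Cs lemmas)
  , ∧ᶠ-⊨p-left φ (⋀ (map clauseF Cs))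
  , RulesOut⇒TReduced-Tred T φ α Cs rulesOut
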